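{- Let $\mathcal{A}$ and $\mathcal{B}$ be nice GFG-tNCWs over the same alphabet with disjoint state sets $Q_\mathcal{A},Q_\mathcal{B}$ and with $L(\mathcal{A})=L(\mathcal{B})$. Then for every state $p\in Q_\mathcal{A}$ there are states $q\in Q_\mathcal{A}$ and $s\in Q_\mathcal{B}$ such that $p\precsim q$ and $q\approx s$; that is, $L(\mathcal{A}^p)=L(\mathcal{A}^q)$, $L_{safe}(\mathcal{A}^p)\subseteq L_{safe}(\mathcal{A}^q)$, $L(\mathcal{A}^q)=L(\mathcal{B}^s)$ and $L_{safe}(\mathcal{A}^q)=L_{safe}(\mathcal{B}^s)$.
   Context: A tNCW is $\mathcal{A}=\langle \Sigma,Q,q_0,\delta,\alpha\rangle$ with finite alphabet $\Sigma$, finite state set $Q$, initial state $q_0$, total transition function $\delta:Q\times\Sigma\to 2^Q\setminus\{\emptyset\}$ with transition relation $\Delta=\{\langle q,\sigma,s\rangle: s\in\delta(q,\sigma)\}$, and $\alpha\subseteq\Delta$ ($\alpha$-transitions; the rest are $\bar\alpha$-transitions); $\delta^{\bar\alpha}(q,\sigma)$ is the set of $\sigma$-successors of $q$ via $\bar\alpha$-transitions. A run on $w=\sigma_1\sigma_2\cdots$ is $r_0r_1\cdots$ with $r_0=q_0$, $r_{i+1}\in\delta(r_i,\sigma_{i+1})$, accepting iff it traverses $\alpha$-transitions only finitely often. $\mathcal{A}^q$ is $\mathcal{A}$ with initial state $q$. $\mathcal{A}$ is GFG if there is $f:\Sigma^*\to Q$ with $f(\epsilon)=q_0$, $\langle f(u),\sigma,f(u\sigma)\rangle\in\Delta$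 for all $u,\sigma$, and for every $w\in L(\mathcal{A})$ the run $f(w[1,0]),f(w[1,1]),\dots$ is accepting; a state $q$ is GFG if $\mathcal{A}^q$ is. A run is safe if it uses no $\alpha$-transition; $L_{safe}(\mathcal{A}^q)$ is the set of infinite words with a safe run from $q$. Within one automaton, $q\sim s$ iff $L(\mathcal{A}^q)=L(\mathcal{A}^s)$. $\mathcal{A}$ is semantically deterministic if any two $\sigma$-successors of a state are $\sim$-equivalent; safe deterministic if $|\delta^{\bar\alpha}(q,\sigma)|\le1$; normal if a path of $\bar\alpha$-transitions from $q$ to $s$ implies one from $s$ to $q$. A GFG-tNCW is nice if all states are reachable and GFG and it is normal, safe deterministic and semantically deterministic. -}

module Defs where

open import Data.Nat using (ℕ; zero; suc; _≤_)
open import Data.Fin using (Fin)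
open import Data.Bool using (Bool; true; false)
open import Data.List using (List; []; _∷_; _++_; [_])
open import Data.Product using (Σ; ∃; _×_; _,_)
open import Relation.Binary.PropositionalEquality using (_≡_)

-- A tNCW over the finite alphabet Fin k with finite state set Fin (states A).
-- δ q σ s ≡ true  iff  ⟨q,σ,s⟩ ∈ Δ ;  α q σ s ≡ true iff ⟨q,σ,s⟩ ∈ α.
record TNCW (k : ℕ) : Set where
  field
    states : ℕ
    q₀     : Fin states
    δ      : Fin states → Fin k → Fin states → Bool
    α      : Fin states → Fin k → Fin states → Bool
    total  : ∀ q σ → ∃ λ s → δ q σ s ≡ true
    α⊆Δ    : ∀ q σ s → α q σ s ≡ true → δ q σ s ≡ true
open TNCW public

State : ∀ {k} → TNCW k → Set
State A = Fin (states A)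

-- infinite words: w i is the (i+1)-th letter σ_{i+1}
Word : ℕ → Set
Word k = ℕ → Fin k

IsRun : ∀ {k} (A : TNCW k) → State A → Word k → (ℕ → State A) → Set
IsRun A q w r = (r 0 ≡ q) × (∀ i → δ A (r i) (w i) (r (suc i)) ≡ true)

AcceptingRun : ∀ {k} (A : TNCW k) → Word k → (ℕ → State A) → Set
AcceptingRun A w r = ∃ λ N → ∀ i → N ≤ i → α A (r i) (w i) (r (suc i)) ≡ false

SafeRun : ∀ {k} (A : TNCW k) → Word k → (ℕ → State A) → Set
SafeRun A w r = ∀ i → α A (r i) (w i) (r (suc i)) ≡ false

Lang : ∀ {k} (A : TNCW k) → State A → Word k → Set
Lang A q w = ∃ λ r → IsRun A q w r × AcceptingRun A w r

LangSafe : ∀ {k} (A : TNCW k) → State A → Word k → Set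
LangSafe A q w = ∃ λ r → IsRun A q w r × SafeRun A w r

_⊆L_ : ∀ {k} → (Word k → Set) → (Word k → Set) → Set
L ⊆L L' = ∀ w → L w → L' w

_≡L_ : ∀ {k} → (Word k → Set) → (Word k → Set) → Set
L ≡L L' = (L ⊆L L') × (L' ⊆L L)

prefix : ∀ {k} → Word k → ℕ → List (Fin k)
prefix w zero    = []
prefix w (suc i) = prefix w i ++ [ w i ]

IsGFGState : ∀ {k} (A : TNCW k) → State A → Set
IsGFGState {k} A q =
  Σ (List (Fin k) → State A) λ f →
    (f [] ≡ q) ×
    (∀ u σ → δ A (f u) σ (f (u ++ [ σ ])) ≡ true) ×
    (∀ w → Lang A q w → AcceptingRun A w (λ i → f (prefix w i)))

IsGFG : ∀ {k} → TNCW k → Set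
IsGFG A = IsGFGState A (q₀ A)

data Path {k} (A : TNCW k) : State A → State A → Set where
  here : ∀ {q} → Path A q q
  step : ∀ {q s t} σ → δ A q σ s ≡ true → Path A s t → Path A q t

data SafePath {k} (A : TNCW k) : State A → State A → Set where
  here : ∀ {q} → SafePath A q q
  step : ∀ {q s t} σ → δ A q σ s ≡ true → α A q σ s ≡ false →
         SafePath A s t → SafePath A q t

Equiv : ∀ {k} (A : TNCW k) → State A → State A → Set
Equiv A q s = Lang A q ≡L Lang A s

AllReachable : ∀ {k} → TNCW k → Set
AllReachable A = ∀ q → Path A (q₀ A) q

AllGFG : ∀ {k} → TNCW k → Set
AllGFG A = ∀ q → IsGFGState A q

Normal : ∀ {k} → TNCW k → Set
Normal A = ∀ q s → SafePath A q s → SafePath A s q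

SafeDeterministic : ∀ {k} → TNCW k → Set
SafeDeterministic A = ∀ q σ s s' →
  δ A q σ s ≡ true → α A q σ s ≡ false →
  δ A q σ s' ≡ true → α A q σ s' ≡ false → s ≡ s'

SemanticallyDeterministic : ∀ {k} → TNCW k → Set
SemanticallyDeterministic A = ∀ q σ s s' →
  δ A q σ s ≡ true → δ A q σ s' ≡ true → Equiv A s s'

Nice : ∀ {k} → TNCW k → Set
Nice A = IsGFG A × AllReachable A × AllGFG A × Normal A ×
         SafeDeterministic A × SemanticallyDeterministic A

-- If A^q can follow a safe word that the safe component of B^s cannot, we may
-- build, using a GFG strategy g for B^s, a word that keeps A safely looping at q
-- and, whenever (q, g(u)) is such an escaping pair, reads the escape: A stays safe,
-- so the word is in L(A^q) = L(B^s), yet g is forced through an α-transition at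
-- every escape. Hence g must eventually reach a state s' with L_safe(A^q) ⊆ L_safe(B^s').
-- Going back and forth between A and B produces a chain of states of A with
-- growing safe languages; by finiteness it revisits a state, and there all the
-- inclusions collapse to equalities.
module Submission where

open import Defs
open import Data.Nat using (ℕ)
open import Data.Product using (Σ; _×_)

open import Data.Nat using (zero; suc; _≤_; _<_; z≤n; s≤s; _≤′_; ≤′-refl; ≤′-step)
open import Data.Nat.Properties using (≤-refl; ≤-trans; n≤1+n; n<1+n; <⇒≤; ≤⇒≤′)
open import Data.Fin using (Fin; toℕ; remQuot)
open import Data.Fin.Properties using (any?; all?; pigeonhole; remQuot-combine)
open import Data.Fin.Subset using (Subset; _∈_; _⊃_)
open import Data.Fin.Subset.Induction using (⊃-wellFounded; Acc; acc)
open import Data.Bool using (true; false)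
open import Data.Bool.Properties using (_≟_)
open import Data.List using (List; []; _∷_; _++_; [_])
open import Data.List.Properties using (∷-injective)
open import Data.List.NonEmpty using (List⁺; _∷⁺_; _⁺++_; toList) renaming ([_] to [_]⁺)
import Data.List.NonEmpty as List⁺
open import Data.Vec using (tabulate)
open import Data.Vec.Properties using (lookup∘tabulate; lookup⇒[]=; []=⇒lookup)
open import Data.Product using (∃; _,_; proj₁; proj₂; map; map₂; uncurry)
open import Data.Sum using (_⊎_; inj₁; inj₂)
open import Data.Unit using (⊤; tt)
open import Function using (_∘_)
open import Relation.Nullary using (¬_; Dec; yes; no; does; contradiction)
open import Relation.Nullary.Decidable using (_×-dec_; ¬?; dec-true)
open import Relation.Unary using (Decidable)
open import Relation.Binary.PropositionalEquality using (_≡_; refl; sym; trans; cong; subst)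

module _ {k : ℕ} where

  ≡L-refl : {L : Word k → Set} → L ≡L L
  ≡L-refl = (λ _ x → x) , (λ _ x → x)

  ≡L-sym : {L L' : Word k → Set} → L ≡L L' → L' ≡L L
  ≡L-sym (L⊆L' , L'⊆L) = L'⊆L , L⊆L'

  ⊆L-trans : {L L' L'' : Word k → Set} → L ⊆L L' → L' ⊆L L'' → L ⊆L L''
  ⊆L-trans L⊆L' L'⊆L'' w = L'⊆L'' w ∘ L⊆L' w

  ≡L-trans : {L L' L'' : Word k → Set} → L ≡L L' → L' ≡L L'' → L ≡L L''
  ≡L-trans (⊆₁ , ⊇₁) (⊆₂ , ⊇₂) = ⊆L-trans ⊆₁ ⊆₂ , ⊆L-trans ⊇₂ ⊇₁

  ⊆L-chain : (L : ℕ → Word k → Set) → (∀ i → L i ⊆L L (suc i)) →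
             ∀ {i j} → i ≤ j → L i ⊆L L j
  ⊆L-chain L grows {i} i≤j = go (≤⇒≤′ i≤j)
    where
      go : ∀ {j} → i ≤′ j → L i ⊆L L j
      go ≤′-refl = λ _ x → x
      go (≤′-step i≤′j) = ⊆L-trans (go i≤′j) (grows _)

_∷ʷ_ : ∀ {k} → Fin k → Word k → Word k
(σ ∷ʷ x) zero    = σ
(σ ∷ʷ x) (suc i) = x i

module _ {k} (C : TNCW k) where

  Lang-∷⁺ : ∀ {q q' σ x} → δ C q σ q' ≡ true → Lang C q' x → Lang C q (σ ∷ʷ x)
  Lang-∷⁺ {q} {σ = σ} {x} d (r , (refl , steps) , N , accepting) =
    r' , (refl , steps') , suc N , accepting'
    where
      r' : ℕ → State C
      r' zero    = q
      r' (suc i) = r i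
      steps' : ∀ i → δ C (r' i) ((σ ∷ʷ x) i) (r' (suc i)) ≡ true
      steps' zero    = d
      steps' (suc i) = steps i
      accepting' : ∀ i → suc N ≤ i → α C (r' i) ((σ ∷ʷ x) i) (r' (suc i)) ≡ false
      accepting' (suc i) (s≤s N≤i) = accepting i N≤i

  Lang-∷⁻ : ∀ {q σ x} → Lang C q (σ ∷ʷ x) → ∃ λ q' → δ C q σ q' ≡ true × Lang C q' x
  Lang-∷⁻ (r , (refl , steps) , N , accepting) =
    r 1 , steps 0 , (r ∘ suc) , (refl , steps ∘ suc) , N ,
    λ i N≤i → accepting (suc i) (≤-trans N≤i (n≤1+n i))

  LangSafe⊆Lang : ∀ {q} → LangSafe C q ⊆L Lang C q
  LangSafe⊆Lang _ (r , run , safe) = r , run , 0 , λ i _ → safe i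

⊆L-step : ∀ {k} {A B : TNCW k} → SemanticallyDeterministic B → ∀ {q s q' s' σ} →
          δ A q σ q' ≡ true → δ B s σ s' ≡ true →
          Lang A q ⊆L Lang B s → Lang A q' ⊆L Lang B s'
⊆L-step {A = A} {B} sdB {s = s} {s' = s'} {σ} dA dB q⊆s x x∈q'
  with Lang-∷⁻ B (q⊆s (σ ∷ʷ x) (Lang-∷⁺ A dA x∈q'))
... | t , dt , x∈t = proj₁ (sdB s σ t s' dt dB) x x∈t

module _ {k} {A B : TNCW k}
         (sdA : SemanticallyDeterministic A) (sdB : SemanticallyDeterministic B) where

  ≡L-step : ∀ {q s q' s' σ} → δ A q σ q' ≡ true → δ B s σ s' ≡ true →
            Lang A q ≡L Lang B s → Lang A q' ≡L Lang B s'
  ≡L-step dA dB (q⊆s , s⊆q) =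
    ⊆L-step {A = A} {B} sdB dA dB q⊆s , ⊆L-step {A = B} {A} sdA dB dA s⊆q

  ≡L-runs : ∀ {q s w rA rB} → IsRun A q w rA → IsRun B s w rB →
            Lang A q ≡L Lang B s → ∀ i → Lang A (rA i) ≡L Lang B (rB i)
  ≡L-runs (refl , _) (refl , _) q≡s zero = q≡s
  ≡L-runs runA runB q≡s (suc i) =
    ≡L-step (proj₂ runA i) (proj₂ runB i) (≡L-runs runA runB q≡s i)

  ≡L-path : ∀ {q p s} → Path A q p → Lang A q ≡L Lang B s →
            ∃ λ s' → Lang A p ≡L Lang B s'
  ≡L-path {s = s} here q≡s = s , q≡s
  ≡L-path {s = s} (step σ d rest) q≡s =
    ≡L-path rest (≡L-step d (proj₂ (total B s σ)) q≡s)

monotone-stabilises : ∀ {m} (P : ℕ → Fin m → Set) → (∀ n → Decidable (P n)) →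
                      (∀ {n x} → P n x → P (suc n) x) →
                      ∃ λ n → ∀ {x} → P (suc n) x → P n x
monotone-stabilises {m} P P? mono = grow 0 (⊃-wellFounded _)
  where
    stage : ℕ → Subset m
    stage n = tabulate (does ∘ P? n)

    stage⁺ : ∀ {n x} → P n x → x ∈ stage n
    stage⁺ {n} {x} p = lookup⇒[]= x _ (trans (lookup∘tabulate _ x) (dec-true (P? n x) p))

    stage⁻ : ∀ {n x} → x ∈ stage n → P n x
    stage⁻ {n} {x} x∈ with P? n x | trans (sym (lookup∘tabulate _ x)) ([]=⇒lookup x∈)
    ... | yes p | _ = p
    ... | no _  | ()

    grow : ∀ n → Acc _⊃_ (stage n) → ∃ λ n → ∀ {x} → P (suc n) x → P n x
    grow n (acc smaller) with any? (λ x → P? (suc n) x ×-dec ¬? (P? n x))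
    ... | yes (x , p , ¬p) =
      grow (suc n) (smaller (stage⁺ ∘ mono ∘ stage⁻ , x , stage⁺ p , ¬p ∘ stage⁻))
    ... | no none = n , stable
      where
        stable : ∀ {x} → P (suc n) x → P n x
        stable {x} p with P? n x
        ... | yes q  = q
        ... | no ¬q = contradiction (x , p , ¬q) none

module _ {k} (C : TNCW k) where

  SafeStep : State C → Fin k → State C → Set
  SafeStep a σ a' = (δ C a σ a' ≡ true) × (α C a σ a' ≡ false)

  safeStep? : ∀ a σ a' → Dec (SafeStep a σ a')
  safeStep? a σ a' = (δ C a σ a' ≟ true) ×-dec (α C a σ a' ≟ false)

  data SafeWalk : State C → List (Fin k) → State C → Set where
    []  : ∀ {a} → SafeWalk a [] a
    _∷_ : ∀ {a σ a' u c} → SafeStep a σ a' → SafeWalk a' u c → SafeWalk a (σ ∷ u) c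

  Loop : State C → Set
  Loop q = Σ (List⁺ (Fin k)) λ u → SafeWalk q (toList u) q

  _++ʷ_ : ∀ {a b c u v} → SafeWalk a u b → SafeWalk b v c → SafeWalk a (u ++ v) c
  [] ++ʷ walk = walk
  (st ∷ walk) ++ʷ walk' = st ∷ (walk ++ʷ walk')

  toSafePath : ∀ {a u c} → SafeWalk a u c → SafePath C a c
  toSafePath []                 = here
  toSafePath ((d , safe) ∷ walk) = step _ d safe (toSafePath walk)

  fromSafePath : ∀ {a c} → SafePath C a c → ∃ λ u → SafeWalk a u c
  fromSafePath here                 = [] , []
  fromSafePath (step σ d safe path) = map (σ ∷_) ((d , safe) ∷_) (fromSafePath path)

  Normal⇒return : Normal C → ∀ {a u c} → SafeWalk a u c → ∃ λ v → SafeWalk a (u ++ v) a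
  Normal⇒return normal walk = map₂ (walk ++ʷ_) (fromSafePath (normal _ _ (toSafePath walk)))

Reads : ∀ {k} → Word k → ℕ → List (Fin k) → Set
Reads w j []      = ⊤
Reads w j (σ ∷ u) = (w j ≡ σ) × Reads w (suc j) u

Reads-++ˡ : ∀ {k} {w : Word k} {j} u {v} → Reads w j (u ++ v) → Reads w j u
Reads-++ˡ []      _            = tt
Reads-++ˡ (_ ∷ u) (wj≡σ , rest) = wj≡σ , Reads-++ˡ u rest

-- The infinite concatenation of nonempty safe loops at q, each chosen from the
-- letters read before it.
module Concatenation {k} (C : TNCW k) (q : State C) (block : List (Fin k) → Loop C q) where

  record Config : Set where
    constructor config
    field
      consumed : List (Fin k)
      state    : State C
      letter   : Fin k
      pending  : List (Fin k)
      walk     : SafeWalk C state (letter ∷ pending) q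
  open Config

  start : List (Fin k) → Config
  start u = let (σ List⁺.∷ v , loop) = block u in config u q σ v loop

  next : Config → Config
  next (config u _ σ _ (_ ∷ []))          = start (u ++ [ σ ])
  next (config u _ σ _ (_ ∷ (st ∷ walk))) = config (u ++ [ σ ]) _ _ _ (st ∷ walk)

  next-consumed : ∀ c → consumed (next c) ≡ consumed c ++ [ letter c ]
  next-consumed (config _ _ _ _ (_ ∷ []))      = refl
  next-consumed (config _ _ _ _ (_ ∷ (_ ∷ _))) = refl

  next-safe : ∀ c → SafeStep C (state c) (letter c) (state (next c))
  next-safe (config _ _ _ _ (st ∷ []))      = st
  next-safe (config _ _ _ _ (st ∷ (_ ∷ _))) = st

  next-pending : ∀ c → (pending c ≡ [] × next c ≡ start (consumed (next c)))
                     ⊎ (pending c ≡ letter (next c) ∷ pending (next c))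
  next-pending (config _ _ _ _ (_ ∷ []))      = inj₁ (refl , refl)
  next-pending (config _ _ _ _ (_ ∷ (_ ∷ _))) = inj₂ refl

  conf : ℕ → Config
  conf zero    = start []
  conf (suc i) = next (conf i)

  word : Word k
  word = letter ∘ conf

  run : ℕ → State C
  run = state ∘ conf

  consumed-prefix : ∀ i → consumed (conf i) ≡ prefix word i
  consumed-prefix zero    = refl
  consumed-prefix (suc i) =
    trans (next-consumed (conf i)) (cong (_++ [ word i ]) (consumed-prefix i))

  run-safe : ∀ i → SafeStep C (run i) (word i) (run (suc i))
  run-safe = next-safe ∘ conf

  word∈LangSafe : LangSafe C q word
  word∈LangSafe = run , (refl , proj₁ ∘ run-safe) , proj₂ ∘ run-safe

  reads-pending : ∀ u i → pending (conf i) ≡ u → Reads word (suc i) u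
  reads-pending []      i _ = tt
  reads-pending (τ ∷ u) i p with next-pending (conf i)
  ... | inj₁ (p≡[] , _) = contradiction (trans (sym p≡[]) p) λ ()
  ... | inj₂ p≡ with ∷-injective (trans (sym p) p≡)
  ...   | τ≡ , u≡ = sym τ≡ , reads-pending u (suc i) (sym u≡)

  fresh-after : ∀ u i → pending (conf i) ≡ u → ∃ λ j → i < j × conf j ≡ start (prefix word j)
  fresh-after u i p with next-pending (conf i)
  ... | inj₁ (_ , fresh) = suc i , ≤-refl , trans fresh (cong start (consumed-prefix (suc i)))
  fresh-after []      i p | inj₂ p≡ = contradiction (trans (sym p) p≡) λ ()
  fresh-after (τ ∷ u) i p | inj₂ p≡ =
    let (j , 1+i<j , fresh) = fresh-after u (suc i) (sym (proj₂ (∷-injective (trans (sym p) p≡))))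
    in j , <⇒≤ 1+i<j , fresh

  block-starts-cofinal : ∀ i → ∃ λ j → i ≤ j × run j ≡ q ×
                                       Reads word j (toList (proj₁ (block (prefix word j))))
  block-starts-cofinal i =
    let (j , i<j , fresh) = fresh-after _ i refl in
    j , <⇒≤ i<j , cong state fresh ,
    subst (λ c → Reads word j (letter c ∷ pending c)) fresh (refl , reads-pending _ j refl)

module _ {k} (A B : TNCW k) where

  NoSafeStep : State B → Fin k → Set
  NoSafeStep b σ = ∀ b' → ¬ SafeStep B b σ b'

  -- Escape n a b: A^a has a safe word of length at most n + 1 that the safe
  -- component of B^b cannot follow.
  data Escape : ℕ → State A → State B → Set where
    stuck : ∀ {n a b a'} σ → SafeStep A a σ a' → NoSafeStep b σ → Escape n a b
    move  : ∀ {n a b a' b'} σ → SafeStep A a σ a' → SafeStep B b σ b' →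
            Escape n a' b' → Escape (suc n) a b

  Escapes : State A → State B → Set
  Escapes a b = ∃ λ n → Escape n a b

  label : ∀ {n a b} → Escape n a b → List⁺ (Fin k)
  label (stuck σ _ _)  = [ σ ]⁺
  label (move σ _ _ e) = σ ∷⁺ label e

  escape-walk : ∀ {n a b} (e : Escape n a b) → ∃ λ a' → SafeWalk A a (toList (label e)) a'
  escape-walk (stuck σ st _)  = _ , st ∷ []
  escape-walk (move σ st _ e) = map₂ (st ∷_) (escape-walk e)

  escape-loop : Normal A → ∀ {n a b} → Escape n a b → Loop A a
  escape-loop normal e =
    let (v , loop) = Normal⇒return A normal (proj₂ (escape-walk e)) in label e ⁺++ v , loop

  escape-loop-reads : ∀ normal {n a b} (e : Escape n a b) {w j} →
                      Reads w j (toList (proj₁ (escape-loop normal e))) → Reads w j (toList (label e))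
  escape-loop-reads _ e = Reads-++ˡ (toList (label e))

  Escape-suc : ∀ {n a b} → Escape n a b → Escape (suc n) a b
  Escape-suc (stuck σ st ns)     = stuck σ st ns
  Escape-suc (move σ stA stB e) = move σ stA stB (Escape-suc e)

  noSafeStep? : ∀ b σ → Dec (NoSafeStep b σ)
  noSafeStep? b σ = all? λ b' → ¬? (safeStep? B b σ b')

  escape? : ∀ n a b → Dec (Escape n a b)
  escape? n a b with any? (λ σ → any? λ a' → safeStep? A a σ a' ×-dec noSafeStep? b σ)
  ... | yes (σ , _ , st , ns) = yes (stuck σ st ns)
  escape? zero a b | no ¬stuck = no λ { (stuck σ st ns) → ¬stuck (σ , _ , st , ns) }
  escape? (suc n) a b | no ¬stuck
    with any? (λ σ → any? λ a' → any? λ b' →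
           safeStep? A a σ a' ×-dec safeStep? B b σ b' ×-dec escape? n a' b')
  ... | yes (σ , _ , _ , stA , stB , e) = yes (move σ stA stB e)
  ... | no ¬move = no λ { (stuck σ st ns)     → ¬stuck (σ , _ , st , ns)
                        ; (move σ stA stB e) → ¬move (σ , _ , _ , stA , stB , e) }

  -- Escape n grows with n inside the finite set State A × State B, so it stops growing.
  private
    stabilised : ∃ λ n → ∀ {a b} → Escape (suc n) a b → Escape n a b
    stabilised with monotone-stabilises (λ n → uncurry (Escape n) ∘ remQuot (states B))
                      (λ n → uncurry (escape? n) ∘ remQuot (states B)) Escape-suc
    ... | n , stable = n , λ {a} {b} e →
      subst (uncurry (Escape n)) (remQuot-combine a b)
        (stable (subst (uncurry (Escape (suc n))) (sym (remQuot-combine a b)) e))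

    lower : ∀ {m a b} → Escape m a b → Escape (proj₁ stabilised) a b
    lower (stuck σ st ns)     = stuck σ st ns
    lower (move σ stA stB e) = proj₂ stabilised (move σ stA stB (lower e))

  escapes? : ∀ a b → Dec (Escapes a b)
  escapes? a b with escape? (proj₁ stabilised) a b
  ... | yes e = yes (_ , e)
  ... | no ¬e = no λ (_ , e) → ¬e (lower e)

  ¬Escapes-step : ∀ {a b σ a'} → ¬ Escapes a b → SafeStep A a σ a' →
                  ∃ λ b' → SafeStep B b σ b' × ¬ Escapes a' b'
  ¬Escapes-step {b = b} {σ} ¬e stA with any? (safeStep? B b σ)
  ... | yes (b' , stB) = b' , stB , λ (n , e) → ¬e (suc n , move σ stA stB e)
  ... | no none = contradiction (0 , stuck σ stA λ b' stB → none (b' , stB)) ¬e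

  ¬Escapes⇒LangSafe-⊆ : ∀ {a b} → ¬ Escapes a b → LangSafe A a ⊆L LangSafe B b
  ¬Escapes⇒LangSafe-⊆ {b = b} ¬e w (r , (refl , steps) , safe) =
    proj₁ ∘ shadow , (refl , proj₁ ∘ shadow-step) , proj₂ ∘ shadow-step
    where
      shadow : ∀ i → Σ (State B) λ b' → ¬ Escapes (r i) b'
      shadow zero    = b , ¬e
      shadow (suc i) = map₂ proj₂ (¬Escapes-step (proj₂ (shadow i)) (steps i , safe i))

      shadow-step : ∀ i → SafeStep B (proj₁ (shadow i)) (w i) (proj₁ (shadow (suc i)))
      shadow-step i = proj₁ (proj₂ (¬Escapes-step (proj₂ (shadow i)) (steps i , safe i)))

  -- By safe determinism, a run of B that stays safe from j on must take the
  -- B-steps of the escape, which end where B has no safe move.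
  Escape⇒α : SafeDeterministic B → ∀ {n a b} (e : Escape n a b)
             {w : Word k} {β : ℕ → State B} {j} → β j ≡ b →
             (∀ m → δ B (β m) (w m) (β (suc m)) ≡ true) → Reads w j (toList (label e)) →
             ¬ (∀ m → j ≤ m → α B (β m) (w m) (β (suc m)) ≡ false)
  Escape⇒α _ (stuck _ _ ns) {w} {β} {j} refl steps (refl , _) safe =
    ns _ (steps j , safe j ≤-refl)
  Escape⇒α sd (move σ _ (d , s) e) {w} {β} {j} refl steps (refl , reads) safe =
    Escape⇒α sd e {w} {β} {suc j} (sd _ σ _ _ (steps j) (safe j ≤-refl) d s) steps reads
      (λ m 1+j≤m → safe m (≤-trans (n≤1+n j) 1+j≤m))

SafelyCovered : ∀ {k} (A B : TNCW k) → State A → Set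
SafelyCovered A B q = Σ (State B) λ s' → (Lang A q ≡L Lang B s') × (LangSafe A q ⊆L LangSafe B s')

module _ {k} {A B : TNCW k} (normal : Normal A)
         (sdA : SemanticallyDeterministic A) (sdB : SemanticallyDeterministic B)
         (safe-det : SafeDeterministic B) where

  -- The word keeps A looping safely at q and reads an escape after every prefix u
  -- with (q, g u) escaping; e₀ only provides some loop at q for the other prefixes.
  private
    module Strategy {q s} (gfg : IsGFGState B s) (q≡s : Lang A q ≡L Lang B s)
                    {n} (e₀ : Escape A B n q s) where

      g : List (Fin k) → State B
      g = proj₁ gfg

      block : List (Fin k) → Loop A q
      block u with escapes? A B q (g u)
      ... | yes (_ , e) = escape-loop A B normal e
      ... | no _        = escape-loop A B normal e₀

      block-reads : ∀ u → Escapes A B q (g u) →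
                    Σ (Escapes A B q (g u)) λ (_ , e) → ∀ {w j} →
                      Reads w j (toList (proj₁ (block u))) → Reads w j (toList (label A B e))
      block-reads u esc with escapes? A B q (g u)
      ... | yes (_ , e) = (_ , e) , escape-loop-reads A B normal e
      ... | no ¬e       = contradiction esc ¬e

      open Concatenation A q block

      g-run : IsRun B s word (g ∘ prefix word)
      g-run = proj₁ (proj₂ gfg) , λ i → proj₁ (proj₂ (proj₂ gfg)) (prefix word i) (word i)

      g-accepting : AcceptingRun B word (g ∘ prefix word)
      g-accepting = proj₂ (proj₂ (proj₂ gfg)) word
                      (proj₁ q≡s word (LangSafe⊆Lang A word word∈LangSafe))

      settled : ∀ j → proj₁ g-accepting ≤ j →
                Reads word j (toList (proj₁ (block (prefix word j)))) →
                ¬ Escapes A B q (g (prefix word j))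
      settled j N≤j reads-j esc =
        let ((_ , e) , reads) = block-reads (prefix word j) esc
        in Escape⇒α A B safe-det e refl (proj₂ g-run) (reads reads-j)
             (λ m j≤m → proj₂ g-accepting m (≤-trans N≤j j≤m))

      cover : SafelyCovered A B q
      cover =
        let (j , N≤j , run-j≡q , reads-j) = block-starts-cofinal (proj₁ g-accepting)
        in g (prefix word j) ,
           subst (λ a → Lang A a ≡L Lang B (g (prefix word j))) run-j≡q
             (≡L-runs {A = A} {B} sdA sdB (refl , proj₁ ∘ run-safe) g-run q≡s j) ,
           ¬Escapes⇒LangSafe-⊆ A B (settled j N≤j reads-j)

  safe-cover : ∀ {q s} → IsGFGState B s → Lang A q ≡L Lang B s → SafelyCovered A B q
  safe-cover {q} {s} gfg q≡s with escapes? A B q s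
  ... | no ¬e      = s , q≡s , ¬Escapes⇒LangSafe-⊆ A B ¬e
  ... | yes (_ , e) = Strategy.cover gfg q≡s e

module _ {k} {A B : TNCW k}
         (coverAB : ∀ {q s} → Lang A q ≡L Lang B s → SafelyCovered A B q)
         (coverBA : ∀ {s q} → Lang B s ≡L Lang A q → SafelyCovered B A s) where

  private
    Matched : Set
    Matched = Σ (State A) λ q → Σ (State B) λ s → Lang A q ≡L Lang B s

    advance : Matched → Matched
    advance (_ , _ , q≡s) =
      let (s' , q≡s' , _) = coverAB q≡s
          (q' , s'≡q' , _) = coverBA (≡L-sym q≡s')
      in q' , s' , ≡L-sym s'≡q'

    advance-lang : ∀ m → Lang A (proj₁ m) ≡L Lang A (proj₁ (advance m))
    advance-lang (_ , _ , q≡s) =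
      ≡L-trans (proj₁ (proj₂ (coverAB q≡s))) (proj₁ (proj₂ (coverBA _)))

    advance-safe : ∀ m → LangSafe A (proj₁ m) ⊆L LangSafe A (proj₁ (advance m))
    advance-safe (_ , _ , q≡s) =
      ⊆L-trans (proj₂ (proj₂ (coverAB q≡s))) (proj₂ (proj₂ (coverBA _)))

    module Iterate {p s} (p≡s : Lang A p ≡L Lang B s) where

      matched : ℕ → Matched
      matched zero    = p , s , p≡s
      matched (suc i) = advance (matched i)

      Q : ℕ → State A
      Q = proj₁ ∘ matched

      Q-lang : ∀ i → Lang A p ≡L Lang A (Q i)
      Q-lang zero    = ≡L-refl
      Q-lang (suc i) = ≡L-trans (Q-lang i) (advance-lang (matched i))

      Q-safe : ∀ {i j} → i ≤ j → LangSafe A (Q i) ⊆L LangSafe A (Q j)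
      Q-safe = ⊆L-chain (LangSafe A ∘ Q) (advance-safe ∘ matched)

      result : Σ (State A) λ q → Σ (State B) λ s' →
                 (Lang A p ≡L Lang A q) × (LangSafe A p ⊆L LangSafe A q) ×
                 (Lang A q ≡L Lang B s') × (LangSafe A q ≡L LangSafe B s')
      result with pigeonhole (n<1+n (states A)) (Q ∘ toℕ)
      ... | i , j , i<j , Qi≡Qj =
        let (s' , q≡s' , q⊆s') = coverAB (proj₂ (proj₂ (matched (toℕ i))))
        in Q (toℕ i) , s' , Q-lang (toℕ i) , Q-safe {j = toℕ i} z≤n , q≡s' , q⊆s' ,
           ⊆L-trans (proj₂ (proj₂ (coverBA (≡L-sym q≡s'))))
             (subst (λ q → LangSafe A (Q (suc (toℕ i))) ⊆L LangSafe A q) (sym Qi≡Qj)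
               (Q-safe i<j))

  safe-equivalent : ∀ {p s} → Lang A p ≡L Lang B s →
    Σ (State A) λ q → Σ (State B) λ s' →
      (Lang A p ≡L Lang A q) × (LangSafe A p ⊆L LangSafe A q) ×
      (Lang A q ≡L Lang B s') × (LangSafe A q ≡L LangSafe B s')
  safe-equivalent = Iterate.result

proposition3p4 : ∀ {k : ℕ} (A B : TNCW k) → Nice A → Nice B →
    Lang A (q₀ A) ≡L Lang B (q₀ B) →
    ∀ (p : State A) → Σ (State A) λ q → Σ (State B) λ s →
      (Lang A p ≡L Lang A q) × (LangSafe A p ⊆L LangSafe A q) ×
      (Lang A q ≡L Lang B s) × (LangSafe A q ≡L LangSafe B s)
proposition3p4 A B (_ , reachableA , gfgA , normalA , safe-detA , sdA)
                   (_ , _ , gfgB , normalB , safe-detB , sdB) q₀≡q₀ p =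
  safe-equivalent {A = A} {B}
    (λ {_} {s} → safe-cover {A = A} {B} normalA sdA sdB safe-detB (gfgB s))
    (λ {_} {q} → safe-cover {A = B} {A} normalB sdB sdA safe-detA (gfgA q))
    (proj₂ (≡L-path {A = A} {B} sdA sdB (reachableA p) q₀≡q₀))
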